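{- Fix polytopes $P_1,\dots,P_r$ and $W$ in $\mathcal{A}[n]$. The set $\mathcal{M}_W$ of all tuples $(Y_1,\dots,Y_r)\in\mathcal{A}[n]^r$ satisfying $W=(P_1\odot Y_1)\oplus(P_2\odot Y_2)\oplus\cdots\oplus(P_r\odot Y_r)$ is finite.
   Context: $\mathcal{A}[n]$: lattice polytopes in $\mathbb{R}^n$ with vertices in $\mathbb{Z}^n_{\ge0}$ (called polytopes) together with $0_{\mathcal{A}}$; $\oplus$ is convex hull of union, $\odot$ is Minkowski sum, $0_{\mathcal{A}}$ is the additive identity and $P\odot0_{\mathcal{A}}=0_{\mathcal{A}}$. -}

module Defs where

open import Level using (0ℓ)
open import Data.Nat using (ℕ)
open import Data.Integer using (+_)
open import Data.Fin using (Fin; zero; suc)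
open import Data.Rational using (ℚ; 0ℚ; 1ℚ; _+_; _*_; _≤_; _/_)
open import Data.Vec using (Vec; map; zipWith; replicate)
open import Data.List using (List; []; _∷_)
open import Data.List.Membership.Propositional using (_∈_)
open import Data.Product using (_×_; ∃-syntax; Σ)
open import Data.Sum using (_⊎_)
open import Data.Empty using (⊥)
open import Relation.Binary.PropositionalEquality using (_≡_)

-- Points of ℚ^n.  All vertices are in ℤ^n_{≥0}, so a polytope is determined by
-- its set of rational points; we work with subsets of ℚ^n.
QPt : ℕ → Set
QPt n = Vec ℚ n

QSet : ℕ → Set₁
QSet n = QPt n → Set

embed : ∀ {n} → Vec ℕ n → QPt n
embed = map (λ k → (+ k) / 1)

_+ᵥ_ : ∀ {n} → QPt n → QPt n → QPt n
_+ᵥ_ = zipWith _+_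

_·ᵥ_ : ∀ {n} → ℚ → QPt n → QPt n
c ·ᵥ v = map (c *_) v

wsum : ∀ {n} → List (ℚ × QPt n) → ℚ
wsum [] = 0ℚ
wsum ((w Data.Product., _) ∷ l) = w + wsum l

wcomb : ∀ {n} → List (ℚ × QPt n) → QPt n
wcomb {n} [] = replicate n 0ℚ
wcomb ((w Data.Product., p) ∷ l) = (w ·ᵥ p) +ᵥ wcomb l

data AllOK {n} (S : QSet n) : List (ℚ × QPt n) → Set where
  []  : AllOK S []
  _∷_ : ∀ {w p l} → (0ℚ ≤ w) × S p → AllOK S l → AllOK S (((w Data.Product., p)) ∷ l)

conv : ∀ {n} → QSet n → QSet n
conv S x = ∃[ l ] (AllOK S l × wsum l ≡ 1ℚ × wcomb l ≡ x)

-- Lattice polytope given by a finite list of vertices in ℤ^n_{≥0};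
-- the empty list gives the empty set, i.e. 0_A.
⟦_⟧ : ∀ {n} → List (Vec ℕ n) → QSet n
⟦ V ⟧ x = conv (λ y → ∃[ v ] (v ∈ V × embed v ≡ y)) x

𝟘 : ∀ {n} → QSet n
𝟘 _ = ⊥

_⊕_ : ∀ {n} → QSet n → QSet n → QSet n
(S ⊕ T) = conv (λ x → S x ⊎ T x)

_⊙_ : ∀ {n} → QSet n → QSet n → QSet n
(S ⊙ T) x = ∃[ s ] ∃[ t ] (S s × T t × s +ᵥ t ≡ x)

⨁ : ∀ {n r} → (Fin r → QSet n) → QSet n
⨁ {r = ℕ.zero} F = 𝟘
⨁ {r = ℕ.suc r} F = F zero ⊕ ⨁ (λ i → F (suc i))

_≐_ : ∀ {n} → QSet n → QSet n → Set
S ≐ T = ∀ x → (S x → T x) × (T x → S x)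

-- A vertex v of Y_i gives the point P_i + v of the i-th summand, hence of W; since P_i ≥ 0,
-- every coordinate of v is bounded by the largest coordinate B of a vertex of W.  So each
-- Y_i is the convex hull of a sublist of the finite box {0,…,B}ⁿ, and there are only
-- finitely many tuples of such sublists.
module Submission where

open import Defs
open import Data.Nat using (ℕ)
open import Data.Fin using (Fin)
open import Data.Vec using (Vec)
open import Data.List using (List; _∷_)
open import Data.List.Membership.Propositional using (_∈_)
open import Data.Product using (_×_; ∃-syntax; Σ)

import Data.Nat as ℕ
import Data.Nat.Properties as ℕ
import Data.Integer as ℤ
import Data.Integer.Properties as ℤ
open import Data.Integer using (+_)
open import Data.Nat.Divisibility using (∣1⇒≡1)
open import Data.Rational using (ℚ; mkℚ; 0ℚ; 1ℚ; _+_; _*_; _≤_; _/_; *≤*; nonNegative)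
import Data.Rational.Properties as ℚ
open import Data.Fin using (zero; suc)
open import Data.Vec using ([]; _∷_; lookup; tabulate; toList; replicate)
import Data.Vec.Properties as Vec
open import Data.Vec.Membership.Propositional.Properties using (∈-lookup; ∈-toList⁺)
open import Data.List using ([]; _++_; map; filter; concatMap; upTo; cartesianProductWith)
import Data.List.Relation.Unary.All as All
import Data.List.Relation.Unary.Any as Any
open import Data.List.Relation.Unary.Any using (here; there)
open import Data.List.Membership.Propositional.Properties
  using (∈-map⁺; ∈-++⁺ˡ; ∈-++⁺ʳ; ∈-filter⁺; ∈-filter⁻; ∈-concatMap⁺; ∈-upTo⁺; ∈-cartesianProductWith⁺)
open import Data.List.Extrema ℕ.≤-totalOrder using (max; xs≤max)
import Data.List.Membership.DecPropositional as DecMembership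
open import Data.Product using (_,_; proj₁; proj₂)
open import Data.Sum using (inj₁; inj₂)
open import Level using (0ℓ)
open import Relation.Nullary using (yes; no)
open import Relation.Unary using (Pred; Decidable)
open import Relation.Binary.PropositionalEquality

ℕ→ℚ : ℕ → ℚ
ℕ→ℚ k = + k / 1

ℕ→ℚ≡mkℚ : ∀ k → ℕ→ℚ k ≡ mkℚ (+ k) 0 (λ p → ∣1⇒≡1 (proj₂ p))
ℕ→ℚ≡mkℚ k = ℚ.normalize-coprime (λ p → ∣1⇒≡1 (proj₂ p))

ℕ→ℚ-mono-≤ : ∀ {a b} → a ℕ.≤ b → ℕ→ℚ a ≤ ℕ→ℚ b
ℕ→ℚ-mono-≤ {a} {b} a≤b rewrite ℕ→ℚ≡mkℚ a | ℕ→ℚ≡mkℚ b =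
  *≤* (subst₂ ℤ._≤_ (sym (ℤ.*-identityʳ (+ a))) (sym (ℤ.*-identityʳ (+ b))) (ℤ.+≤+ a≤b))

ℕ→ℚ-cancel-≤ : ∀ {a b} → ℕ→ℚ a ≤ ℕ→ℚ b → a ℕ.≤ b
ℕ→ℚ-cancel-≤ {a} {b} h rewrite ℕ→ℚ≡mkℚ a | ℕ→ℚ≡mkℚ b =
  ℤ.drop‿+≤+ (subst₂ ℤ._≤_ (ℤ.*-identityʳ (+ a)) (ℤ.*-identityʳ (+ b)) (ℚ.drop-*≤* h))

lookup-embed : ∀ {n} (v : Vec ℕ n) j → lookup (embed v) j ≡ ℕ→ℚ (lookup v j)
lookup-embed v j = Vec.lookup-map j _ v

lookup-+ᵥ : ∀ {n} (x y : QPt n) j → lookup (x +ᵥ y) j ≡ lookup x j + lookup y j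
lookup-+ᵥ x y j = Vec.lookup-zipWith _+_ j x y

∈-conv : ∀ {n} {S : QSet n} {x} → S x → conv S x
∈-conv {x = x} Sx = (1ℚ , x) ∷ [] , (ℚ.nonNegative⁻¹ 1ℚ , Sx) ∷ [] , ℚ.+-identityʳ 1ℚ , unit x
  where
  unit : ∀ {n} (y : QPt n) → (1ℚ ·ᵥ y) +ᵥ replicate n 0ℚ ≡ y
  unit [] = refl
  unit (a ∷ y) = cong₂ _∷_ (trans (ℚ.+-identityʳ (1ℚ * a)) (ℚ.*-identityˡ a)) (unit y)

conv-mono : ∀ {n} {S T : QSet n} → (∀ x → S x → T x) → ∀ x → conv S x → conv T x
conv-mono S⊆T x (l , ok , sum≡1 , comb≡x) = l , weaken ok , sum≡1 , comb≡x
  where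
  weaken : ∀ {l} → AllOK _ l → AllOK _ l
  weaken [] = []
  weaken ((w≥0 , Sp) ∷ ok) = (w≥0 , S⊆T _ Sp) ∷ weaken ok

wcomb-lookup-≤ : ∀ {n} {S : QSet n} b j → (∀ p → S p → lookup p j ≤ b) →
                 ∀ l → AllOK S l → lookup (wcomb l) j ≤ wsum l * b
wcomb-lookup-≤ b j bounded [] [] =
  subst₂ _≤_ (sym (Vec.lookup-replicate j 0ℚ)) (sym (ℚ.*-zeroˡ b)) ℚ.≤-refl
wcomb-lookup-≤ b j bounded ((w , p) ∷ l) ((w≥0 , Sp) ∷ ok) =
  subst₂ _≤_ (sym lookup-cons) (sym (ℚ.*-distribʳ-+ b w (wsum l)))
    (ℚ.+-mono-≤ (ℚ.*-monoˡ-≤-nonNeg w {{nonNegative w≥0}} (bounded p Sp))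
                (wcomb-lookup-≤ b j bounded l ok))
  where
  lookup-cons : lookup (wcomb ((w , p) ∷ l)) j ≡ w * lookup p j + lookup (wcomb l) j
  lookup-cons = trans (lookup-+ᵥ (w ·ᵥ p) (wcomb l) j)
                      (cong (_+ lookup (wcomb l) j) (Vec.lookup-map j (w *_) p))

conv-lookup-≤ : ∀ {n} {S : QSet n} b j → (∀ p → S p → lookup p j ≤ b) →
                ∀ x → conv S x → lookup x j ≤ b
conv-lookup-≤ b j bounded x (l , ok , sum≡1 , refl) =
  subst (lookup (wcomb l) j ≤_) (trans (cong (_* b) sum≡1) (ℚ.*-identityˡ b))
    (wcomb-lookup-≤ b j bounded l ok)

⨁-summand : ∀ {n r} (F : Fin r → QSet n) i {x} → F i x → ⨁ F x
⨁-summand F zero Fx = ∈-conv (inj₁ Fx)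
⨁-summand F (suc i) Fx = ∈-conv (inj₂ (⨁-summand (λ k → F (suc k)) i Fx))

vertex-∈-⟦⟧ : ∀ {n} {V : List (Vec ℕ n)} {v} → v ∈ V → ⟦ V ⟧ (embed v)
vertex-∈-⟦⟧ {v = v} v∈V = ∈-conv (v , v∈V , refl)

⟦⟧-mono : ∀ {n} {A B : List (Vec ℕ n)} → (∀ v → v ∈ A → v ∈ B) → ∀ x → ⟦ A ⟧ x → ⟦ B ⟧ x
⟦⟧-mono A⊆B = conv-mono (λ _ (v , v∈A , eq) → v , A⊆B v v∈A , eq)

maxCoord : ∀ {n} → List (Vec ℕ n) → ℕ
maxCoord V = max 0 (concatMap toList V)

lookup-≤-maxCoord : ∀ {n} {V : List (Vec ℕ n)} {v} → v ∈ V → ∀ j → lookup v j ℕ.≤ maxCoord V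
lookup-≤-maxCoord {V = V} {v} v∈V j =
  All.lookup (xs≤max 0 (concatMap toList V))
    (∈-concatMap⁺ toList (Any.map (λ { refl → ∈-toList⁺ (∈-lookup j v) }) v∈V))

⟦⟧-lookup-≤ : ∀ {n} (V : List (Vec ℕ n)) j x → ⟦ V ⟧ x → lookup x j ≤ ℕ→ℚ (maxCoord V)
⟦⟧-lookup-≤ V j = conv-lookup-≤ (ℕ→ℚ (maxCoord V)) j vertex-bounded
  where
  vertex-bounded : ∀ p → ∃[ v ] (v ∈ V × embed v ≡ p) → lookup p j ≤ ℕ→ℚ (maxCoord V)
  vertex-bounded _ (v , v∈V , refl) =
    subst (_≤ _) (sym (lookup-embed v j)) (ℕ→ℚ-mono-≤ (lookup-≤-maxCoord v∈V j))

summand-vertex-≤-maxCoord : ∀ {n r} (W : List (Vec ℕ n)) (P : Fin r → Vec ℕ n)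
  (Ps Y : Fin r → List (Vec ℕ n)) → ⟦ W ⟧ ≐ ⨁ (λ i → ⟦ P i ∷ Ps i ⟧ ⊙ ⟦ Y i ⟧) →
  ∀ i {v} → v ∈ Y i → ∀ j → lookup v j ℕ.≤ maxCoord W
summand-vertex-≤-maxCoord {n} W P Ps Y W≐⨁ i {v} v∈Yi j =
  ℕ→ℚ-cancel-≤ (ℚ.≤-trans v≤P+v (⟦⟧-lookup-≤ W j x x∈W))
  where
  x : QPt n
  x = embed (P i) +ᵥ embed v
  x∈W : ⟦ W ⟧ x
  x∈W = proj₂ (W≐⨁ x) (⨁-summand _ i
          (embed (P i) , embed v , vertex-∈-⟦⟧ (here refl) , vertex-∈-⟦⟧ v∈Yi , refl))
  v≤P+v : ℕ→ℚ (lookup v j) ≤ lookup x j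
  v≤P+v = subst₂ _≤_ (ℚ.+-identityˡ _)
            (sym (trans (lookup-+ᵥ (embed (P i)) (embed v) j)
                        (cong₂ _+_ (lookup-embed (P i) j) (lookup-embed v j))))
            (ℚ.+-monoˡ-≤ (ℕ→ℚ (lookup v j)) (ℕ→ℚ-mono-≤ {0} {lookup (P i) j} ℕ.z≤n))

vecsOver : ∀ {A : Set} r → List A → List (Vec A r)
vecsOver ℕ.zero c = [] ∷ []
vecsOver (ℕ.suc r) c = cartesianProductWith _∷_ c (vecsOver r c)

∈-vecsOver : ∀ {A : Set} {r} (c : List A) (v : Vec A r) → (∀ i → lookup v i ∈ c) → v ∈ vecsOver r c
∈-vecsOver c [] _ = here refl
∈-vecsOver c (a ∷ v) v⊆c =
  ∈-cartesianProductWith⁺ _∷_ (v⊆c zero) (∈-vecsOver c v (λ i → v⊆c (suc i)))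

box : ∀ n → ℕ → List (Vec ℕ n)
box n B = vecsOver n (upTo (ℕ.suc B))

∈-box : ∀ {n} B (v : Vec ℕ n) → (∀ j → lookup v j ℕ.≤ B) → v ∈ box n B
∈-box B v v≤B = ∈-vecsOver _ v (λ j → ∈-upTo⁺ (ℕ.s≤s (v≤B j)))

sublists : ∀ {A : Set} → List A → List (List A)
sublists [] = [] ∷ []
sublists (x ∷ xs) = map (x ∷_) (sublists xs) ++ sublists xs

filter-∈-sublists : ∀ {A : Set} {P : Pred A 0ℓ} (P? : Decidable P) xs → filter P? xs ∈ sublists xs
filter-∈-sublists P? [] = here refl
filter-∈-sublists P? (x ∷ xs) with P? x
... | yes _ = ∈-++⁺ˡ (∈-map⁺ (x ∷_) (filter-∈-sublists P? xs))
... | no _ = ∈-++⁺ʳ (map (x ∷_) (sublists xs)) (filter-∈-sublists P? xs)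

⟦⟧-sublists-representative : ∀ {n} (C Y : List (Vec ℕ n)) → (∀ v → v ∈ Y → v ∈ C) →
  ∃[ Z ] (Z ∈ sublists C × ⟦ Y ⟧ ≐ ⟦ Z ⟧)
⟦⟧-sublists-representative {n} C Y Y⊆C =
  filter (_∈? Y) C , filter-∈-sublists (_∈? Y) C ,
  λ x → ⟦⟧-mono (λ v v∈Y → ∈-filter⁺ (_∈? Y) (Y⊆C v v∈Y) v∈Y) x ,
        ⟦⟧-mono (λ v v∈Z → proj₂ (∈-filter⁻ (_∈? Y) {xs = C} v∈Z)) x
  where open DecMembership (Vec.≡-dec {n = n} ℕ._≟_) using (_∈?_)

tuples-representative : ∀ {A B : Set} {r} (R : A → B → Set) (c : List B) (Y : Fin r → A) →
  (∀ i → ∃[ z ] (z ∈ c × R (Y i) z)) →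
  ∃[ Y′ ] (Y′ ∈ map lookup (vecsOver r c) × ∀ i → R (Y i) (Y′ i))
tuples-representative {B = B} {r} R c Y rep =
  lookup zs ,
  ∈-map⁺ lookup (∈-vecsOver c zs λ i → subst (_∈ c) (sym (lookup-zs i)) (proj₁ (proj₂ (rep i)))) ,
  λ i → subst (R (Y i)) (sym (lookup-zs i)) (proj₂ (proj₂ (rep i)))
  where
  zs : Vec B r
  zs = tabulate (λ i → proj₁ (rep i))
  lookup-zs : ∀ i → lookup zs i ≡ proj₁ (rep i)
  lookup-zs = Vec.lookup∘tabulate _

mainTheorem9 : (n r : ℕ) (P : Fin r → Vec ℕ n) (Ps : Fin r → List (Vec ℕ n))
    (w : Vec ℕ n) (Ws : List (Vec ℕ n)) →
    Σ (List (Fin r → List (Vec ℕ n))) λ L → (∀ (Y : Fin r → List (Vec ℕ n)) →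
      ⟦ w ∷ Ws ⟧ ≐ ⨁ (λ i → ⟦ P i ∷ Ps i ⟧ ⊙ ⟦ Y i ⟧) →
      ∃[ Y′ ] (Y′ ∈ L × (∀ i → ⟦ Y i ⟧ ≐ ⟦ Y′ i ⟧)))
mainTheorem9 n r P Ps w Ws =
  map lookup (vecsOver r (sublists C)) , λ Y W≐⨁ →
    tuples-representative (λ A B → ⟦ A ⟧ ≐ ⟦ B ⟧) (sublists C) Y λ i →
      ⟦⟧-sublists-representative C (Y i) λ v v∈Yi →
        ∈-box (maxCoord (w ∷ Ws)) v (summand-vertex-≤-maxCoord (w ∷ Ws) P Ps Y W≐⨁ i v∈Yi)
  where
  C : List (Vec ℕ n)
  C = box n (maxCoord (w ∷ Ws))
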